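{- Let $\ell\ge 1$, $n\ge 1$ and $k\ge 0$ be integers, and let $K_{n,\ldots,n}$ be the complete $\ell$-partite graph each of whose $\ell$ partite sets has $n$ vertices. Then $K_{n,\ldots,n}$ has an equitable $(t,k)$-tree-coloring for every integer $t$ of the form $t=\ell h$ with $h\geq 1$ an integer.
   Context: All graphs are finite and simple. A $t$-coloring of a graph $G$ is a map $f:V(G)\to\{1,\dots,t\}$, with color classes $V_i=\{v: f(v)=i\}$. It is equitable if $\big||V_i|-|V_j|\big|\le 1$ for all $i,j$. A $(t,k)$-tree-coloring of $G$ is a $t$-coloring such that every connected component of each induced subgraph $G[V_i]$ is a tree of maximum degree at most $k$; an equitable $(t,k)$-tree-coloring is a $(t,k)$-tree-coloring that is equitable. -}

module Defs where

open import Data.Nat using (ℕ; zero; suc; _+_; _*_; _≤_)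
open import Data.Fin using (Fin; zero; suc; inject₁; fromℕ; quotient; _≟_)
open import Data.Fin.Properties using () renaming (_≟_ to _≟ᶠ_)
open import Data.List using (List; length; filter)
open import Data.List.Base using ()
open import Data.Fin.Base using ()
open import Data.List using () renaming (map to lmap)
open import Data.Product using (Σ; _×_; _,_; ∃)
open import Relation.Nullary using (¬_; Dec)
open import Relation.Nullary.Decidable using (_×-dec_; ¬?)
open import Relation.Binary.PropositionalEquality using (_≡_)
open import Function.Definitions using (Injective)
open import Data.List using (allFin) public

record Graph : Set₁ where
  field
    N      : ℕ
    _~_    : Fin N → Fin N → Set
    _~?_   : ∀ u v → Dec (u ~ v)
    sym~   : ∀ {u v} → u ~ v → v ~ u
    irrefl : ∀ {u} → ¬ (u ~ u)

open Graph public

Coloring : Graph → ℕ → Set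
Coloring G t = Fin (N G) → Fin t

classSize : (G : Graph) {t : ℕ} → Coloring G t → Fin t → ℕ
classSize G f i = length (filter (λ v → f v ≟ i) (allFin (N G)))

Equitable : (G : Graph) {t : ℕ} → Coloring G t → Set
Equitable G f = ∀ i j → classSize G f i ≤ suc (classSize G f j)

InducedAdj : (G : Graph) {t : ℕ} → Coloring G t → Fin (N G) → Fin (N G) → Set
InducedAdj G f u v = _~_ G u v × f u ≡ f v

inducedDeg : (G : Graph) {t : ℕ} → Coloring G t → Fin (N G) → ℕ
inducedDeg G f v = length (filter (λ u → _~?_ G v u ×-dec (f v ≟ f u)) (allFin (N G)))

-- A cycle of length m+3 in the induced subgraphs of the coloring:
-- distinct vertices c 0, …, c (m+2), consecutive ones (cyclically) adjacent
-- and of the same color.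
record MonoCycle (G : Graph) {t : ℕ} (f : Coloring G t) : Set where
  field
    m       : ℕ
    c       : Fin (suc (suc (suc m))) → Fin (N G)
    inj     : Injective _≡_ _≡_ c
    step    : ∀ (i : Fin (suc (suc m))) → InducedAdj G f (c (inject₁ i)) (c (suc i))
    close   : InducedAdj G f (c (fromℕ (suc (suc m)))) (c zero)

-- (t,k)-tree-coloring: every component of each G[V_i] is a tree (i.e. each
-- G[V_i] is acyclic) of maximum degree at most k.
TreeColoring : (G : Graph) (t k : ℕ) → Coloring G t → Set
TreeColoring G t k f = (∀ v → inducedDeg G f v ≤ k) × ¬ MonoCycle G f

EquitableTreeColoring : (G : Graph) (t k : ℕ) → Coloring G t → Set
EquitableTreeColoring G t k f = TreeColoring G t k f × Equitable G f

-- complete ℓ-partite graph K_{n,…,n}: vertex v ∈ Fin (ℓ * n) lies in part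
-- quotient n v ∈ Fin ℓ; two vertices are adjacent iff in different parts.
part : (ℓ n : ℕ) → Fin (ℓ * n) → Fin ℓ
part ℓ n v = quotient {ℓ} n v

completeMultipartite : (ℓ n : ℕ) → Graph
completeMultipartite ℓ n = record
  { N      = ℓ * n
  ; _~_    = λ u v → ¬ (part ℓ n u ≡ part ℓ n v)
  ; _~?_   = λ u v → ¬? (part ℓ n u ≟ part ℓ n v)
  ; sym~   = λ p q → p (Relation.Binary.PropositionalEquality.sym q)
  ; irrefl = λ p → p Relation.Binary.PropositionalEquality.refl
  }

-- Cut every part of K_{n,…,n} into h blocks whose sizes differ by at most
-- one, and give block j of part q its own colour (q , j).  Each colour class
-- then lies inside a single part, so it is an independent set: every induced
-- subgraph G[V_i] is edgeless, hence a forest of maximum degree 0 ≤ k.  The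
-- class of (q , j) has the size of block j, so the colouring is equitable.
module Submission where

open import Defs
open import Data.Nat using (ℕ; zero; suc; _+_; _*_; _≤_; _≥_; z≤n; s≤s)
open import Data.Nat.Properties using (≤-trans; m≤n+m; +-identityʳ)
open import Data.Nat.ListAction using (sum)
open import Data.Fin using (Fin; zero; suc; _↑ˡ_; _↑ʳ_; combine; quotient; remainder; _≟_)
open import Data.Fin.Properties
  using (suc-injective; combine-remQuot; remQuot-combine; combine-injectiveˡ; combine-injectiveʳ)
open import Data.List using (tabulate; length; filter)
open import Data.List.Extrema.Nat using (argmin; f[argmin]≤f[xs])
open import Data.List.Membership.Propositional.Properties using (∈-allFin)
open import Data.List.Relation.Unary.All using (lookup)
open import Data.Vec.Functional using (_∷_)
open import Data.Product using (Σ; ∃; _,_)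
open import Function using (_∘_; id)
open import Level using (Level)
open import Relation.Binary.PropositionalEquality
open import Relation.Nullary using (¬_; yes; no; contradiction)
open import Relation.Nullary.Decidable using (_×-dec_)
open import Relation.Unary using (Pred; Decidable)

private
  variable
    a p q : Level
    A : Set a

count : ∀ {m} {P : Pred (Fin m) p} → Decidable P → ℕ
count {m = zero}  P? = 0
count {m = suc m} P? with P? zero
... | yes _ = suc (count (P? ∘ suc))
... | no  _ = count (P? ∘ suc)

length-filter-tabulate : ∀ {m} {P : Pred A p} (P? : Decidable P) (f : Fin m → A) →
  length (filter P? (tabulate f)) ≡ count (P? ∘ f)
length-filter-tabulate {m = zero}  P? f = refl
length-filter-tabulate {m = suc m} P? f with P? (f zero)
... | yes _ = cong suc (length-filter-tabulate P? (f ∘ suc))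
... | no  _ = length-filter-tabulate P? (f ∘ suc)

count-cong : ∀ {m} {P : Pred (Fin m) p} {Q : Pred (Fin m) q}
  (P? : Decidable P) (Q? : Decidable Q) →
  (∀ i → P i → Q i) → (∀ i → Q i → P i) → count P? ≡ count Q?
count-cong {m = zero}  P? Q? P⇒Q Q⇒P = refl
count-cong {m = suc m} P? Q? P⇒Q Q⇒P with P? zero | Q? zero
... | yes _  | yes _  = cong suc (count-cong (P? ∘ suc) (Q? ∘ suc) (P⇒Q ∘ suc) (Q⇒P ∘ suc))
... | no  _  | no  _  = count-cong (P? ∘ suc) (Q? ∘ suc) (P⇒Q ∘ suc) (Q⇒P ∘ suc)
... | yes Pz | no ¬Qz = contradiction (P⇒Q zero Pz) ¬Qz
... | no ¬Pz | yes Qz = contradiction (Q⇒P zero Qz) ¬Pz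

count-none : ∀ {m} {P : Pred (Fin m) p} (P? : Decidable P) → (∀ i → ¬ P i) → count P? ≡ 0
count-none {m = zero}  P? ¬P = refl
count-none {m = suc m} P? ¬P with P? zero
... | yes Pz = contradiction Pz (¬P zero)
... | no  _  = count-none (P? ∘ suc) (¬P ∘ suc)

count-↑ : ∀ m {c} {P : Pred (Fin (m + c)) p} (P? : Decidable P) →
  count P? ≡ count (P? ∘ (_↑ˡ c)) + count (P? ∘ (m ↑ʳ_))
count-↑ zero    P? = refl
count-↑ (suc m) P? with P? zero
... | yes _ = cong suc (count-↑ m (P? ∘ suc))
... | no  _ = count-↑ m (P? ∘ suc)

count-combine : ∀ ℓ {n} {P : Pred (Fin (ℓ * n)) p} (P? : Decidable P) →
  count P? ≡ sum (tabulate (λ q → count (P? ∘ combine {ℓ} {n} q)))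
count-combine zero        P? = refl
count-combine (suc ℓ) {n} P? =
  trans (count-↑ n P?) (cong (count (P? ∘ (_↑ˡ (ℓ * n))) +_) (count-combine ℓ (P? ∘ (n ↑ʳ_))))

sum-tabulate-single : ∀ {ℓ} (F : Fin ℓ → ℕ) (q : Fin ℓ) →
  (∀ q′ → q′ ≢ q → F q′ ≡ 0) → sum (tabulate F) ≡ F q
sum-tabulate-single F zero F≡0 =
  trans (cong (F zero +_) (sum-zero (F ∘ suc) (λ q′ → F≡0 (suc q′) λ ()))) (+-identityʳ (F zero))
  where
  sum-zero : ∀ {ℓ} (G : Fin ℓ → ℕ) → (∀ q′ → G q′ ≡ 0) → sum (tabulate G) ≡ 0
  sum-zero {zero}  G G≡0 = refl
  sum-zero {suc ℓ} G G≡0 = cong₂ _+_ (G≡0 zero) (sum-zero (G ∘ suc) (G≡0 ∘ suc))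
sum-tabulate-single F (suc q) F≡0 =
  cong₂ _+_ (F≡0 zero λ ())
    (sum-tabulate-single (F ∘ suc) q (λ q′ q′≢q → F≡0 (suc q′) (q′≢q ∘ suc-injective)))

count-block : ∀ ℓ {n} {P : Pred (Fin (ℓ * n)) p} (P? : Decidable P) (q : Fin ℓ) →
  (∀ q′ r → q′ ≢ q → ¬ P (combine {ℓ} {n} q′ r)) → count P? ≡ count (P? ∘ combine q)
count-block ℓ {n} P? q outside = trans (count-combine ℓ P?)
  (sum-tabulate-single _ q λ q′ q′≢q → count-none (P? ∘ combine {ℓ} {n} q′) (λ r → outside q′ r q′≢q))

fibreSize : ∀ {n h} → (Fin n → Fin h) → Fin h → ℕ
fibreSize g j = count (λ r → g r ≟ j)

Balanced : ∀ {n h} → (Fin n → Fin h) → Set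
Balanced g = ∀ j j′ → fibreSize g j ≤ suc (fibreSize g j′)

∷-balanced : ∀ {n h} {g : Fin n → Fin h} {m : Fin h} → Balanced g →
  (∀ j → fibreSize g m ≤ fibreSize g j) → Balanced (m ∷ g)
∷-balanced {m = m} g-balanced m-minimal j j′ with m ≟ j | m ≟ j′
... | yes refl | yes _ = s≤s (g-balanced j j′)
... | yes refl | no  _ = s≤s (m-minimal j′)
... | no  _    | yes _ = ≤-trans (g-balanced j j′) (s≤s (m≤n+m _ 1))
... | no  _    | no  _ = g-balanced j j′

-- Greedily send each new point to a smallest fibre.
balanced-exists : ∀ n h → Σ (Fin n → Fin (suc h)) Balanced
balanced-exists zero    h = (λ ()) , λ _ _ → z≤n
balanced-exists (suc n) h with balanced-exists n h
... | g , g-balanced = smallest ∷ g , ∷-balanced {g = g} g-balanced smallest-minimal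
  where
  smallest : Fin (suc h)
  smallest = argmin (fibreSize g) zero (allFin (suc h))

  smallest-minimal : ∀ j → fibreSize g smallest ≤ fibreSize g j
  smallest-minimal j =
    lookup (f[argmin]≤f[xs] {f = fibreSize g} zero (allFin (suc h))) (∈-allFin j)

independent⇒treeColoring : ∀ (G : Graph) {t} (f : Coloring G t) →
  (∀ u v → ¬ InducedAdj G f u v) → ∀ k → TreeColoring G t k f
independent⇒treeColoring G f independent k = degree-bound , no-cycle
  where
  degree-bound : ∀ v → inducedDeg G f v ≤ k
  degree-bound v = subst (_≤ k) (sym inducedDeg≡0) z≤n
    where
    adjacent-same-colour? : Decidable (InducedAdj G f v)
    adjacent-same-colour? u = (_~?_ G v u) ×-dec (f v ≟ f u)

    inducedDeg≡0 : inducedDeg G f v ≡ 0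
    inducedDeg≡0 = trans (length-filter-tabulate adjacent-same-colour? id)
      (count-none adjacent-same-colour? (independent v))

  no-cycle : ¬ MonoCycle G f
  no-cycle cycle = independent _ _ (MonoCycle.close cycle)

module BlockColouring (ℓ n h : ℕ) (g : Fin n → Fin h) where

  G : Graph
  G = completeMultipartite ℓ n

  colour : Coloring G (ℓ * h)
  colour v = combine (part ℓ n v) (g (remainder {ℓ} n v))

  colour-combine : ∀ q r → colour (combine q r) ≡ combine q (g r)
  colour-combine q r = cong (λ (q′ , r′) → combine q′ (g r′)) (remQuot-combine {ℓ} {n} q r)

  colour-class-independent : ∀ u v → ¬ InducedAdj G colour u v
  colour-class-independent u v (different-parts , same-colour) =
    different-parts (combine-injectiveˡ (part ℓ n u) _ (part ℓ n v) _ same-colour)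

  classSize-combine : ∀ q j → classSize G colour (combine q j) ≡ fibreSize g j
  classSize-combine q j = begin
    classSize G colour (combine q j)
      ≡⟨ length-filter-tabulate (λ v → colour v ≟ combine q j) id ⟩
    count (λ v → colour v ≟ combine q j)
      ≡⟨ count-block ℓ _ q other-block ⟩
    count (λ r → colour (combine q r) ≟ combine q j)
      ≡⟨ count-cong _ _ same-block (λ r g[r]≡j → trans (colour-combine q r) (cong (combine q) g[r]≡j)) ⟩
    fibreSize g j
      ∎
    where
    open ≡-Reasoning
    other-block : ∀ q′ r → q′ ≢ q → colour (combine q′ r) ≢ combine q j
    other-block q′ r q′≢q eq =
      q′≢q (combine-injectiveˡ q′ (g r) q j (trans (sym (colour-combine q′ r)) eq))

    same-block : ∀ r → colour (combine q r) ≡ combine q j → g r ≡ j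
    same-block r eq = combine-injectiveʳ q (g r) q j (trans (sym (colour-combine q r)) eq)

  colour-equitable : Balanced g → Equitable G colour
  colour-equitable balanced i i′ =
    subst₂ (λ x y → x ≤ suc y) (sym (classSize≡fibreSize i)) (sym (classSize≡fibreSize i′))
      (balanced _ _)
    where
    classSize≡fibreSize : ∀ i → classSize G colour i ≡ fibreSize g (remainder {ℓ} h i)
    classSize≡fibreSize i = trans (cong (classSize G colour) (sym (combine-remQuot {ℓ} h i)))
      (classSize-combine (quotient {ℓ} h i) (remainder {ℓ} h i))

proposition1 : (ℓ n k h : ℕ) → ℓ ≥ 1 → n ≥ 1 → h ≥ 1 →
    ∃ λ (f : Coloring (completeMultipartite ℓ n) (ℓ * h)) →
      EquitableTreeColoring (completeMultipartite ℓ n) (ℓ * h) k f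
proposition1 ℓ n k (suc h) _ _ _ with balanced-exists n h
... | g , g-balanced =
  colour , independent⇒treeColoring G colour colour-class-independent k , colour-equitable g-balanced
  where open BlockColouring ℓ n (suc h) g
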